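{- Let $M$ be a thread-register model and $s$ a reachable state of $M$, with components $s_t$ in the thread LTS $T_t$ and $s_r$ in the register LTS $R_r$. If $s_r$ enables $\mathit{ow}_{t,r}$ (respectively $\mathit{or}_{t,r}$) in $R_r$, then $s_t$ enables $\mathit{fw}_{t,r}$ (respectively an action $\mathit{fr}_{t,r}(d)$) in $T_t$. Moreover, if $s_r$ enables $c=\mathit{fw}_{t,r}$ or $c=\mathit{fr}_{t,r}(d)$, then $s_t$ also enables $c$, and thus $s$ enables $c$ in $M$.
   Context: An LTS is a tuple $(S,\mathit{Act},\mathit{init},\mathit{Trans})$ with finite $S$, finite $\mathit{Act}$, $\mathit{init}\in S$, $\mathit{Trans}\subseteq S\times\mathit{Act}\times S$; $a$ is enabled in $s$ if $(s,a,s')\in\mathit{Trans}$ for some $s'$. A path is a nonempty finite or infinite alternating sequence $s_0a_1s_1\ldots$ with $(s_i,a_{i+1},s_{i+1})\in\mathit{Trans}$. The parallel composition of LTSs $P_i=(S_i,\mathit{Act}_i,\mathit{init}_i,\mathit{Trans}_i)$, $i=1..k$, has states $S_1\times\cdots\times S_k$, actions $\bigcup_i\mathit{Act}_i$, initial state $(\mathit{init}_i)_i$, and a transition $((s_i)_i,a,(s'_i)_i)$ iff for every $i$: $s'_i=s_i$ if $a\notin\mathit{Act}_i$, and $(s_i,a,s'_i)\in\mathit{Trans}_i$ if $a\in\mathit{Act}_i$. Registers. Fix disjoint finite sets $\mathbb T$ (thread ids) and $\mathbb R$ (register ids); each $r\in\mathbb R$ has a finite domain $D_r$ and initial value $d^0_r$.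 For $t\in\mathbb T$, $r\in\mathbb R$, $d\in D_r$ the register actions are $\mathit{sr}_{t,r}$, $\mathit{fr}_{t,r}(d)$, $\mathit{sw}_{t,r}(d)$, $\mathit{fw}_{t,r}$ (interface) and $\mathit{or}_{t,r}$, $\mathit{ow}_{t,r}$ (register-local). States of a register LTS for $r$ are statuses $s$ with components $\mathit{stor}(s)\in D_r$, $\mathit{rds}(s),\mathit{wrts}(s),\mathit{pend}(s)\subseteq\mathbb T$, and per $t$: $\mathit{rec}(s,t)\in D_r$, $\mathit{ovrl}(s,t)\in\{\mathit{true},\mathit{false}\}$, $\mathit{posv}(s,t)\subseteq D_r$; initially $\mathit{stor}=d^0_r$, $\mathit{rds}=\mathit{wrts}=\mathit{pend}=\emptyset$, $\mathit{rec}(t)=d^0_r$, $\mathit{ovrl}(t)=\mathit{false}$, $\mathit{posv}(t)=\emptyset$. Updates (unmentioned components unchanged, right sides evaluated in $s$): $\mathit{usr}(s,t)$: add $t$ to $\mathit{rds},\mathit{pend}$; $\mathit{ovrl}(t):=(\mathit{wrts}(s)\neq\emptyset)$; $\mathit{posv}(t):=\{\mathit{stor}(s)\}\cup\{\mathit{rec}(s,t'):t'\in\mathit{wrts}(s)\}$. $\mathit{ufr}(s,t)$: remove $t$ from $\mathit{rds}$. $\mathit{usw}(s,t,d)$: add $t$ to $\mathit{wrts},\mathit{pend}$; $\mathit{rec}(t):=d$; $\mathit{ovrl}(t):=(\mathit{wrts}(s)\neq\emptyset)$; for all $t'\neq t$: $\mathit{ovrl}(t'):=\mathit{true}$, $\mathit{posv}(t'):=\mathit{posv}(s,t')\cup\{d\}$.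 $\mathit{ufw}(s,t,d)$: $\mathit{stor}:=d$, remove $t$ from $\mathit{wrts}$. $\mathit{uor}(s,t)$: remove $t$ from $\mathit{pend}$, $\mathit{rec}(t):=\mathit{stor}(s)$. $\mathit{uow}(s,t,d)$: $\mathit{stor}:=d$, remove $t$ from $\mathit{pend}$. In each register LTS, for all $s,t,d$: if $t\notin\mathit{rds}(s)\cup\mathit{wrts}(s)$, transitions $s\xrightarrow{\mathit{sr}_{t,r}}\mathit{usr}(s,t)$ and $s\xrightarrow{\mathit{sw}_{t,r}(d)}\mathit{usw}(s,t,d)$; further: Safe: $t\in\mathit{rds}(s)$, $\neg\mathit{ovrl}(s,t)$: $\mathit{fr}_{t,r}(\mathit{stor}(s))$ to $\mathit{ufr}(s,t)$; $t\in\mathit{rds}(s)$, $\mathit{ovrl}(s,t)$: $\mathit{fr}_{t,r}(d)$ to $\mathit{ufr}(s,t)$; $t\in\mathit{wrts}(s)$, $\neg\mathit{ovrl}(s,t)$: $\mathit{fw}_{t,r}$ to $\mathit{ufw}(s,t,\mathit{rec}(s,t))$; $t\in\mathit{wrts}(s)$, $\mathit{ovrl}(s,t)$: $\mathit{fw}_{t,r}$ to $\mathit{ufw}(s,t,d)$. Regular: $t\in\mathit{rds}(s)$, $d\in\mathit{posv}(s,t)$: $\mathit{fr}_{t,r}(d)$ to $\mathit{ufr}(s,t)$; $t\in\mathit{wrts}(s)\cap\mathit{pend}(s)$: $\mathit{ow}_{t,r}$ to $\mathit{uow}(s,t,\mathit{rec}(s,t))$; $t\in\mathit{wrts}(s)\setminus\mathit{pend}(s)$: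 $\mathit{fw}_{t,r}$ to $\mathit{ufw}(s,t,\mathit{stor}(s))$. Atomic: $t\in\mathit{rds}(s)\cap\mathit{pend}(s)$: $\mathit{or}_{t,r}$ to $\mathit{uor}(s,t)$; $t\in\mathit{wrts}(s)\cap\mathit{pend}(s)$: $\mathit{ow}_{t,r}$ to $\mathit{uow}(s,t,\mathit{rec}(s,t))$; $t\in\mathit{rds}(s)\setminus\mathit{pend}(s)$: $\mathit{fr}_{t,r}(\mathit{rec}(s,t))$ to $\mathit{ufr}(s,t)$; $t\in\mathit{wrts}(s)\setminus\mathit{pend}(s)$: $\mathit{fw}_{t,r}$ to $\mathit{ufw}(s,t,\mathit{stor}(s))$. Threads. Each $t\in\mathbb T$ has a thread LTS $T_t$ with actions $\{\mathit{sr}_{t,r},\mathit{fr}_{t,r}(d),\mathit{sw}_{t,r}(d),\mathit{fw}_{t,r}:r\in\mathbb R,d\in D_r\}\cup\mathit{TLoc}_t$, the thread-local sets $\mathit{TLoc}_t$ pairwise disjoint and disjoint from register actions; on every path from its initial state, each $\mathit{sr}_{t,r}$-transition leads to a state where exactly the $\mathit{fr}_{t,r}(d)$, $d\in D_r$, are enabled, each $\mathit{sw}_{t,r}(d)$-transition leads to a state where only $\mathit{fw}_{t,r}$ is enabled, and $\mathit{fr}_{t,r}(d)$, $\mathit{fw}_{t,r}$ are enabled only in such states. A thread-register model $M$ is the parallel composition of all $T_t$ ($t\in\mathbb T$) and, for each $r\in\mathbb R$, one register LTS $R_r$ for $r$ that is a safe, regular or atomic register LTS. For a state $s$ of $M$,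 $s_t$ and $s_r$ denote its components in $T_t$ and $R_r$. -}

module Defs where

open import Data.Nat using (ℕ; zero; suc)
open import Data.Fin using (Fin; _≟_)
import Data.Fin as F
open import Data.Bool using (Bool; true; false; _∨_; _∧_; if_then_else_)
open import Data.Product using (Σ; ∃; _×_; _,_)
open import Data.Maybe using (Maybe; just; nothing)
open import Data.Empty using (⊥)
open import Relation.Binary.PropositionalEquality using (_≡_)
open import Relation.Nullary using (¬_; does)
open import Function.Bundles using (_⇔_)

_==_ : ∀ {n} → Fin n → Fin n → Bool
x == y = does (x ≟ y)

anyFin : ∀ n → (Fin n → Bool) → Bool
anyFin zero    f = false
anyFin (suc n) f = f F.zero ∨ anyFin n (λ i → f (F.suc i))

-- Signature: thread ids 𝕋 = Fin nT, register ids ℝ = Fin nR,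
-- domains D_r = Fin (D r), initial values d0 r, thread-local action
-- sets TLoc_t = Fin (L t) (tagged by t, hence pairwise disjoint and
-- disjoint from the register actions).

record Sig : Set where
  field
    nT nR : ℕ
    D     : Fin nR → ℕ
    d0    : (r : Fin nR) → Fin (D r)
    L     : Fin nT → ℕ

module _ (σ : Sig) where
  open Sig σ

  Tid : Set
  Tid = Fin nT

  Rid : Set
  Rid = Fin nR

  Val : Rid → Set
  Val r = Fin (D r)

  data Act : Set where
    sr  : Tid → (r : Rid) → Act
    fr  : Tid → (r : Rid) → Val r → Act
    sw  : Tid → (r : Rid) → Val r → Act
    fw  : Tid → Rid → Act
    or  : Tid → Rid → Act
    ow  : Tid → Rid → Act
    loc : (t : Tid) → Fin (L t) → Act

  InThread : Tid → Act → Set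
  InThread t (sr t' _)    = t ≡ t'
  InThread t (fr t' _ _)  = t ≡ t'
  InThread t (sw t' _ _)  = t ≡ t'
  InThread t (fw t' _)    = t ≡ t'
  InThread t (or _ _)     = ⊥
  InThread t (ow _ _)     = ⊥
  InThread t (loc t' _)   = t ≡ t'

  InReg : Rid → Act → Set
  InReg r (sr _ r')   = r ≡ r'
  InReg r (fr _ r' _) = r ≡ r'
  InReg r (sw _ r' _) = r ≡ r'
  InReg r (fw _ r')   = r ≡ r'
  InReg r (or _ r')   = r ≡ r'
  InReg r (ow _ r')   = r ≡ r'
  InReg r (loc _ _)   = ⊥

  Enabled : {S : Set} → (S → Act → S → Set) → S → Act → Set
  Enabled {S} Tr s a = Σ S (λ s' → Tr s a s')

  data Path {S : Set} (i : S) (Tr : S → Act → S → Set) : S → Set where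
    here : Path i Tr i
    step : ∀ {s a s'} → Path i Tr s → Tr s a s' → Path i Tr s'

  lastAct : ∀ {S : Set} {i : S} {Tr : S → Act → S → Set} {s : S} →
            Path i Tr s → Maybe Act
  lastAct here              = nothing
  lastAct (step {a = a} _ _) = just a

  record ThreadLTS (t : Tid) : Set₁ where
    field
      nS     : ℕ
      init   : Fin nS
      Trans  : Fin nS → Act → Fin nS → Set
      alph   : ∀ {s a s'} → Trans s a s' → InThread t a
      afterSr : ∀ {s s' r} → Path init Trans s → Trans s (sr t r) s' →
                ∀ a → Enabled Trans s' a ⇔ (Σ (Val r) λ d → a ≡ fr t r d)
      afterSw : ∀ {s s' r d} → Path init Trans s → Trans s (sw t r d) s' →
                ∀ a → Enabled Trans s' a ⇔ (a ≡ fw t r)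
      frOnly : ∀ {s r d} → (p : Path init Trans s) →
               Enabled Trans s (fr t r d) → lastAct p ≡ just (sr t r)
      fwOnly : ∀ {s r} → (p : Path init Trans s) →
               Enabled Trans s (fw t r) →
               Σ (Val r) λ d → lastAct p ≡ just (sw t r d)

  -- Register statuses (subsets of Tid / Val r as Boolean predicates)

  record Status (r : Rid) : Set where
    field
      stor : Val r
      rds  : Tid → Bool
      wrts : Tid → Bool
      pend : Tid → Bool
      rec  : Tid → Val r
      ovrl : Tid → Bool
      posv : Tid → Val r → Bool
  open Status public

  initStatus : (r : Rid) → Status r
  initStatus r = record
    { stor = d0 r ; rds = λ _ → false ; wrts = λ _ → false ; pend = λ _ → false
    ; rec = λ _ → d0 r ; ovrl = λ _ → false ; posv = λ _ _ → false }

  upd : {A : Set} → (Tid → A) → Tid → A → Tid → A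
  upd f t v t' = if t' == t then v else f t'

  module _ {r : Rid} where
    usr : Status r → Tid → Status r
    usr s t = record s
      { rds  = upd (rds s) t true
      ; pend = upd (pend s) t true
      ; ovrl = upd (ovrl s) t (anyFin nT (wrts s))
      ; posv = upd (posv s) t
                 (λ d → (d == stor s) ∨ anyFin nT (λ t' → wrts s t' ∧ (rec s t' == d)))
      }

    ufr : Status r → Tid → Status r
    ufr s t = record s { rds = upd (rds s) t false }

    usw : Status r → Tid → Val r → Status r
    usw s t d = record s
      { wrts = upd (wrts s) t true
      ; pend = upd (pend s) t true
      ; rec  = upd (rec s) t d
      ; ovrl = λ t' → if t' == t then anyFin nT (wrts s) else true
      ; posv = λ t' → if t' == t then posv s t' else (λ e → posv s t' e ∨ (e == d))
      }

    ufw : Status r → Tid → Val r → Status r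
    ufw s t d = record s { stor = d ; wrts = upd (wrts s) t false }

    uor : Status r → Tid → Status r
    uor s t = record s { pend = upd (pend s) t false ; rec = upd (rec s) t (stor s) }

    uow : Status r → Tid → Val r → Status r
    uow s t d = record s { stor = d ; pend = upd (pend s) t false }

  data Kind : Set where
    safe regular atomic : Kind

  data RegStep : Kind → (r : Rid) → Status r → Act → Status r → Set where
    startR  : ∀ {k r s t} → rds s t ≡ false → wrts s t ≡ false →
              RegStep k r s (sr t r) (usr s t)
    startW  : ∀ {k r s t d} → rds s t ≡ false → wrts s t ≡ false →
              RegStep k r s (sw t r d) (usw s t d)
    safeFr₁ : ∀ {r s t} → rds s t ≡ true → ovrl s t ≡ false →
              RegStep safe r s (fr t r (stor s)) (ufr s t)
    safeFr₂ : ∀ {r s t d} → rds s t ≡ true → ovrl s t ≡ true →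
              RegStep safe r s (fr t r d) (ufr s t)
    safeFw₁ : ∀ {r s t} → wrts s t ≡ true → ovrl s t ≡ false →
              RegStep safe r s (fw t r) (ufw s t (rec s t))
    safeFw₂ : ∀ {r s t} (d : Val r) → wrts s t ≡ true → ovrl s t ≡ true →
              RegStep safe r s (fw t r) (ufw s t d)
    regFr   : ∀ {r s t d} → rds s t ≡ true → posv s t d ≡ true →
              RegStep regular r s (fr t r d) (ufr s t)
    regOw   : ∀ {r s t} → wrts s t ≡ true → pend s t ≡ true →
              RegStep regular r s (ow t r) (uow s t (rec s t))
    regFw   : ∀ {r s t} → wrts s t ≡ true → pend s t ≡ false →
              RegStep regular r s (fw t r) (ufw s t (stor s))
    atOr    : ∀ {r s t} → rds s t ≡ true → pend s t ≡ true →
              RegStep atomic r s (or t r) (uor s t)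
    atOw    : ∀ {r s t} → wrts s t ≡ true → pend s t ≡ true →
              RegStep atomic r s (ow t r) (uow s t (rec s t))
    atFr    : ∀ {r s t} → rds s t ≡ true → pend s t ≡ false →
              RegStep atomic r s (fr t r (rec s t)) (ufr s t)
    atFw    : ∀ {r s t} → wrts s t ≡ true → pend s t ≡ false →
              RegStep atomic r s (fw t r) (ufw s t (stor s))

  -- Thread-register models: parallel composition of all thread LTSs and,
  -- for each register r, a register LTS of kind (kind r).

  record Model : Set₁ where
    field
      thread : (t : Tid) → ThreadLTS t
      kind   : Rid → Kind

  module _ (M : Model) where
    open Model M

    TState : Tid → Set
    TState t = Fin (ThreadLTS.nS (thread t))

    TTrans : (t : Tid) → TState t → Act → TState t → Set
    TTrans t = ThreadLTS.Trans (thread t)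

    record MState : Set where
      constructor mstate
      field
        th : (t : Tid) → TState t
        rg : (r : Rid) → Status r
    open MState public

    minit : MState
    minit = mstate (λ t → ThreadLTS.init (thread t)) initStatus

    MTrans : MState → Act → MState → Set
    MTrans s a s' =
      ((t : Tid) → (InThread t a → TTrans t (th s t) a (th s' t))
                 × (¬ InThread t a → th s' t ≡ th s t))
      × ((r : Rid) → (InReg r a → RegStep (kind r) r (rg s r) a (rg s' r))
                   × (¬ InReg r a → rg s' r ≡ rg s r))

    Reachable : MState → Set
    Reachable = Path minit MTrans

    ThEnabled : MState → Tid → Act → Set
    ThEnabled s t a = Enabled (TTrans t) (th s t) a

    RegEnabled : MState → Rid → Act → Set
    RegEnabled s r a = Enabled (RegStep (kind r) r) (rg s r) a

    MEnabled : MState → Act → Set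
    MEnabled s a = Enabled MTrans s a

{-# OPTIONS --safe #-}
-- In every reachable state each thread t has a path to its current local state whose
-- last action is sr_{t,r} whenever R_r records t as reading, and some sw_{t,r}(d)
-- whenever R_r records t as writing: the register flags of t are only set by t's own
-- start actions, and the thread axioms forbid t to act before the matching fr/fw.
-- The same axioms then say the thread state enables the fr_{t,r}(d) (resp. fw_{t,r}),
-- and an fr or fw action synchronises only T_t and R_r.
module Submission where

open import Defs
open import Data.Bool using (Bool; true; false; if_then_else_)
open import Data.Empty using (⊥; ⊥-elim)
open import Data.Fin using (_≟_)
open import Data.Maybe using (Maybe; just)
open import Data.Product using (Σ; _×_; _,_; proj₁; proj₂)
open import Function.Bundles using (_⇔_; Equivalence)
open import Function.Construct.Identity using (⇔-id)
open import Relation.Binary.PropositionalEquality using (_≡_; refl; sym; trans; subst; cong)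
open import Relation.Nullary using (¬_; Dec; yes; no)
open import Relation.Nullary.Decidable using (dec-true; dec-false)

module _ (σ : Sig) where

  inThread? : ∀ t a → Dec (InThread σ t a)
  inThread? t (sr t' _)   = t ≟ t'
  inThread? t (fr t' _ _) = t ≟ t'
  inThread? t (sw t' _ _) = t ≟ t'
  inThread? t (fw t' _)   = t ≟ t'
  inThread? t (or _ _)    = no λ ()
  inThread? t (ow _ _)    = no λ ()
  inThread? t (loc t' _)  = t ≟ t'

  inReg? : ∀ r a → Dec (InReg σ r a)
  inReg? r (sr _ r')   = r ≟ r'
  inReg? r (fr _ r' _) = r ≟ r'
  inReg? r (sw _ r' _) = r ≟ r'
  inReg? r (fw _ r')   = r ≟ r'
  inReg? r (or _ r')   = r ≟ r'
  inReg? r (ow _ r')   = r ≟ r'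
  inReg? r (loc _ _)   = no λ ()

  upd-same : ∀ {A : Set} (f : Tid σ → A) t v → upd σ f t v t ≡ v
  upd-same f t v = cong (λ b → if b then v else f t) (dec-true (t ≟ t) refl)

  upd-other : ∀ {A : Set} (f : Tid σ → A) {t t'} v → ¬ t' ≡ t → upd σ f t v t' ≡ f t'
  upd-other f {t} {t'} v t'≢t = cong (λ b → if b then v else f t') (dec-false (t' ≟ t) t'≢t)

  flag-clash : ∀ {b} → b ≡ true → b ≡ false → ⊥
  flag-clash refl ()

  upd-cleared : (f : Tid σ → Bool) (t : Tid σ) → ¬ upd σ f t false t ≡ true
  upd-cleared f t set = flag-clash set (upd-same f t false)

  module _ {t : Tid σ} (T : ThreadLTS σ t) where
    open ThreadLTS T

    sr-last⇒only-fr-enabled : ∀ {x r} (p : Path σ init Trans x) → lastAct σ p ≡ just (sr t r) →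
                              ∀ {a} → Enabled σ Trans x a → Σ (Val σ r) λ d → a ≡ fr t r d
    sr-last⇒only-fr-enabled (step p tr) refl = Equivalence.to (afterSr p tr _)

    sr-last⇒fr-enabled : ∀ {x r} (p : Path σ init Trans x) → lastAct σ p ≡ just (sr t r) →
                         ∀ d → Enabled σ Trans x (fr t r d)
    sr-last⇒fr-enabled (step p tr) refl d = Equivalence.from (afterSr p tr _) (d , refl)

    sw-last⇒only-fw-enabled : ∀ {x r d} (p : Path σ init Trans x) → lastAct σ p ≡ just (sw t r d) →
                              ∀ {a} → Enabled σ Trans x a → a ≡ fw t r
    sw-last⇒only-fw-enabled (step p tr) refl = Equivalence.to (afterSw p tr _)

    sw-last⇒fw-enabled : ∀ {x r d} (p : Path σ init Trans x) → lastAct σ p ≡ just (sw t r d) →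
                         Enabled σ Trans x (fw t r)
    sw-last⇒fw-enabled (step p tr) refl = Equivalence.from (afterSw p tr _) refl

  Reading : ∀ {r} → Status σ r → Tid σ → Set
  Reading st t = rds st t ≡ true

  Writing : ∀ {r} → Status σ r → Tid σ → Set
  Writing st t = wrts st t ≡ true

  Idle : ∀ {r} → Status σ r → Tid σ → Set
  Idle st t = ¬ Reading st t × ¬ Writing st t

  record Tracks (t : Tid σ) {r : Rid σ} (last : Maybe (Act σ)) (st : Status σ r) : Set where
    field
      reading⇒sr : Reading st t → last ≡ just (sr t r)
      writing⇒sw : Writing st t → Σ (Val σ r) λ d → last ≡ just (sw t r d)
  open Tracks

  idle⇒tracks : ∀ {t r last} {st : Status σ r} → Idle st t → Tracks t last st
  idle⇒tracks (¬rd , ¬wr) = record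
    { reading⇒sr = λ rd → ⊥-elim (¬rd rd)
    ; writing⇒sw = λ wr → ⊥-elim (¬wr wr)
    }

  tracks⇒exclusive : ∀ {t r last} {st : Status σ r} → Tracks t last st →
                     Reading st t → Writing st t → ⊥
  tracks⇒exclusive T rd wr with trans (sym (reading⇒sr T rd)) (proj₂ (writing⇒sw T wr))
  ... | ()

  idle-after-read : ∀ {t r last} {st : Status σ r} → Tracks t last st → Reading st t →
                    Idle (ufr σ st t) t
  idle-after-read {t} {st = st} T rd = upd-cleared (rds st) t , tracks⇒exclusive T rd

  idle-after-write : ∀ {t r last} {st : Status σ r} → Tracks t last st → Writing st t →
                     ∀ d → Idle (ufw σ st t d) t
  idle-after-write {t} {st = st} T wr d = (λ rd → tracks⇒exclusive T rd wr) , upd-cleared (wrts st) t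

  step-preserves-flags : ∀ {k r st a st' t} → RegStep σ k r st a st' → ¬ InThread σ t a →
                         rds st' t ≡ rds st t × wrts st' t ≡ wrts st t
  step-preserves-flags {st = st} (startR _ _)      t≢ = upd-other (rds st) true t≢ , refl
  step-preserves-flags {st = st} (startW _ _)      t≢ = refl , upd-other (wrts st) true t≢
  step-preserves-flags {st = st} (safeFr₁ _ _)     t≢ = upd-other (rds st) false t≢ , refl
  step-preserves-flags {st = st} (safeFr₂ _ _)     t≢ = upd-other (rds st) false t≢ , refl
  step-preserves-flags {st = st} (regFr _ _)       t≢ = upd-other (rds st) false t≢ , refl
  step-preserves-flags {st = st} (atFr _ _)        t≢ = upd-other (rds st) false t≢ , refl
  step-preserves-flags {st = st} (safeFw₁ _ _)     t≢ = refl , upd-other (wrts st) false t≢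
  step-preserves-flags {st = st} (safeFw₂ _ _ _)   t≢ = refl , upd-other (wrts st) false t≢
  step-preserves-flags {st = st} (regFw _ _)       t≢ = refl , upd-other (wrts st) false t≢
  step-preserves-flags {st = st} (atFw _ _)        t≢ = refl , upd-other (wrts st) false t≢
  step-preserves-flags           (regOw _ _)       _  = refl , refl
  step-preserves-flags           (atOw _ _)        _  = refl , refl
  step-preserves-flags           (atOr _ _)        _  = refl , refl

  tracks-frame : ∀ {k r st a st' t last} → Tracks t last st → RegStep σ k r st a st' →
                 ¬ InThread σ t a → Tracks t last st'
  tracks-frame T rstep t∉a with step-preserves-flags rstep t∉a
  ... | rds≡ , wrts≡ = record
    { reading⇒sr = λ rd → reading⇒sr T (trans (sym rds≡) rd)
    ; writing⇒sw = λ wr → writing⇒sw T (trans (sym wrts≡) wr)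
    }

  tracks-step : ∀ {k r st a st' t last} → Tracks t last st → RegStep σ k r st a st' →
                InThread σ t a → Tracks t (just a) st'
  tracks-step T (startR _ ¬wr) refl =
    record { reading⇒sr = λ _ → refl ; writing⇒sw = λ wr → ⊥-elim (flag-clash wr ¬wr) }
  tracks-step T (startW ¬rd _) refl =
    record { reading⇒sr = λ rd → ⊥-elim (flag-clash rd ¬rd) ; writing⇒sw = λ _ → _ , refl }
  tracks-step                       T (safeFr₁ rd _)   refl = idle⇒tracks (idle-after-read T rd)
  tracks-step                       T (safeFr₂ rd _)   refl = idle⇒tracks (idle-after-read T rd)
  tracks-step                       T (regFr rd _)     refl = idle⇒tracks (idle-after-read T rd)
  tracks-step                       T (atFr rd _)      refl = idle⇒tracks (idle-after-read T rd)
  tracks-step {st = st} {t = t}     T (safeFw₁ wr _)   refl = idle⇒tracks (idle-after-write T wr (rec st t))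
  tracks-step                       T (safeFw₂ d wr _) refl = idle⇒tracks (idle-after-write T wr d)
  tracks-step {st = st}             T (regFw wr _)     refl = idle⇒tracks (idle-after-write T wr (stor st))
  tracks-step {st = st}             T (atFw wr _)      refl = idle⇒tracks (idle-after-write T wr (stor st))
  tracks-step                       _ (regOw _ _)      ()
  tracks-step                       _ (atOw _ _)       ()
  tracks-step                       _ (atOr _ _)       ()

  idle-unless-involved : ∀ {t r} {st : Status σ r} (T : ThreadLTS σ t) {x x' a} →
                         (p : Path σ (ThreadLTS.init T) (ThreadLTS.Trans T) x) →
                         Tracks t (lastAct σ p) st → ThreadLTS.Trans T x a x' → ¬ InReg σ r a → Idle st t
  idle-unless-involved T p tracks tr r∉a =
    (λ rd → r∉a (frs-involve (sr-last⇒only-fr-enabled T p (reading⇒sr tracks rd) (_ , tr)))) ,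
    (λ wr → r∉a (fws-involve (sw-last⇒only-fw-enabled T p (proj₂ (writing⇒sw tracks wr)) (_ , tr))))
    where
      frs-involve : ∀ {t r a} → Σ (Val σ r) (λ d → a ≡ fr t r d) → InReg σ r a
      frs-involve (_ , refl) = refl
      fws-involve : ∀ {t r a} → a ≡ fw t r → InReg σ r a
      fws-involve refl = refl

  fr-requires-reading : ∀ {k r st t d st'} → RegStep σ k r st (fr t r d) st' → Reading st t
  fr-requires-reading (safeFr₁ rd _) = rd
  fr-requires-reading (safeFr₂ rd _) = rd
  fr-requires-reading (regFr rd _)   = rd
  fr-requires-reading (atFr rd _)    = rd

  fw-requires-writing : ∀ {k r st t st'} → RegStep σ k r st (fw t r) st' → Writing st t
  fw-requires-writing (safeFw₁ wr _)   = wr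
  fw-requires-writing (safeFw₂ _ wr _) = wr
  fw-requires-writing (regFw wr _)     = wr
  fw-requires-writing (atFw wr _)      = wr

  or-requires-reading : ∀ {k r st t st'} → RegStep σ k r st (or t r) st' → Reading st t
  or-requires-reading (atOr rd _) = rd

  ow-requires-writing : ∀ {k r st t st'} → RegStep σ k r st (ow t r) st' → Writing st t
  ow-requires-writing (regOw wr _) = wr
  ow-requires-writing (atOw wr _)  = wr

module _ (σ : Sig) (M : Model σ) where
  open Model M

  ThreadPath : (t : Tid σ) → TState σ M t → Set
  ThreadPath t = Path σ (ThreadLTS.init (thread t)) (TTrans σ M t)

  TrackingPath : (t : Tid σ) → TState σ M t → ((r : Rid σ) → Status σ r) → Set
  TrackingPath t x regs = Σ (ThreadPath t x) λ p → ∀ r → Tracks σ t (lastAct σ p) (regs r)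

  Consistent : MState σ M → Set
  Consistent s = ∀ t → TrackingPath t (th s t) (rg s)

  initial-consistent : Consistent (minit σ M)
  initial-consistent t = here , λ r → idle⇒tracks σ ((λ ()) , (λ ()))

  actor-tracked : ∀ {s a s'} → Consistent s → MTrans σ M s a s' →
                  ∀ t → InThread σ t a → TrackingPath t (th s' t) (rg s')
  actor-tracked {s} {a} {s'} consistent (threads , regs) t t∈a = step p tr , tracks
    where
      p = proj₁ (consistent t)
      tr = proj₁ (threads t) t∈a
      tracks : ∀ r → Tracks σ t (just a) (rg s' r)
      tracks r with inReg? σ r a
      ... | yes r∈a = tracks-step σ (proj₂ (consistent t) r) (proj₁ (regs r) r∈a) t∈a
      ... | no r∉a  = subst (Tracks σ t (just a)) (sym (proj₂ (regs r) r∉a))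
                        (idle⇒tracks σ (idle-unless-involved σ (thread t) p (proj₂ (consistent t) r) tr r∉a))

  bystander-tracked : ∀ {s a s'} → Consistent s → MTrans σ M s a s' →
                      ∀ t → ¬ InThread σ t a → TrackingPath t (th s' t) (rg s')
  bystander-tracked {s} {a} {s'} consistent (threads , regs) t t∉a =
    subst (λ x → TrackingPath t x (rg s')) (sym (proj₂ (threads t) t∉a)) (p , tracks)
    where
      p = proj₁ (consistent t)
      tracks : ∀ r → Tracks σ t (lastAct σ p) (rg s' r)
      tracks r with inReg? σ r a
      ... | yes r∈a = tracks-frame σ (proj₂ (consistent t) r) (proj₁ (regs r) r∈a) t∉a
      ... | no r∉a  = subst (Tracks σ t (lastAct σ p)) (sym (proj₂ (regs r) r∉a)) (proj₂ (consistent t) r)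

  reachable⇒consistent : ∀ {s} → Reachable σ M s → Consistent s
  reachable⇒consistent here = initial-consistent
  reachable⇒consistent (step {a = a} reach mstep) t with inThread? σ t a
  ... | yes t∈a = actor-tracked (reachable⇒consistent reach) mstep t t∈a
  ... | no t∉a  = bystander-tracked (reachable⇒consistent reach) mstep t t∉a

  jointly-enabled : ∀ {s a} t r → (∀ t' → InThread σ t' a ⇔ t' ≡ t) → (∀ r' → InReg σ r' a ⇔ r' ≡ r) →
                    ThEnabled σ M s t a → RegEnabled σ M s r a → MEnabled σ M s a
  jointly-enabled {s} {a} t r threads-of regs-of (x , tr) (st' , rstep) =
    mstate (λ t' → pick-thread (t' ≟ t)) (λ r' → pick-reg (r' ≟ r)) ,
      (λ t' → thread-step t' (t' ≟ t)) , (λ r' → reg-step r' (r' ≟ r))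
    where
      pick-thread : ∀ {t'} → Dec (t' ≡ t) → TState σ M t'
      pick-thread (yes refl)  = x
      pick-thread {t'} (no _) = th s t'

      pick-reg : ∀ {r'} → Dec (r' ≡ r) → Status σ r'
      pick-reg (yes refl)  = st'
      pick-reg {r'} (no _) = rg s r'

      thread-step : ∀ t' (t'≟t : Dec (t' ≡ t)) →
                    (InThread σ t' a → TTrans σ M t' (th s t') a (pick-thread t'≟t))
                  × (¬ InThread σ t' a → pick-thread t'≟t ≡ th s t')
      thread-step t' (yes refl) = (λ _ → tr) , (λ t∉a → ⊥-elim (t∉a (Equivalence.from (threads-of t') refl)))
      thread-step t' (no t'≢t)  = (λ t'∈a → ⊥-elim (t'≢t (Equivalence.to (threads-of t') t'∈a))) , (λ _ → refl)

      reg-step : ∀ r' (r'≟r : Dec (r' ≡ r)) →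
                 (InReg σ r' a → RegStep σ (kind r') r' (rg s r') a (pick-reg r'≟r))
               × (¬ InReg σ r' a → pick-reg r'≟r ≡ rg s r')
      reg-step r' (yes refl) = (λ _ → rstep) , (λ r∉a → ⊥-elim (r∉a (Equivalence.from (regs-of r') refl)))
      reg-step r' (no r'≢r)  = (λ r'∈a → ⊥-elim (r'≢r (Equivalence.to (regs-of r') r'∈a))) , (λ _ → refl)

lemma15 : (σ : Sig) (M : Model σ) (s : MState σ M) → Reachable σ M s →
    (t : Tid σ) (r : Rid σ) →
      (RegEnabled σ M s r (ow t r) → ThEnabled σ M s t (fw t r))
    × (RegEnabled σ M s r (or t r) → Σ (Val σ r) (λ d → ThEnabled σ M s t (fr t r d)))
    × (RegEnabled σ M s r (fw t r) → ThEnabled σ M s t (fw t r) × MEnabled σ M s (fw t r))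
    × ((d : Val σ r) → RegEnabled σ M s r (fr t r d) →
         ThEnabled σ M s t (fr t r d) × MEnabled σ M s (fr t r d))
lemma15 σ M s reachable t r =
    (λ (_ , rstep) → fw-enabled (ow-requires-writing σ rstep))
  , (λ (_ , rstep) → Sig.d0 σ r , fr-enabled (or-requires-reading σ rstep) (Sig.d0 σ r))
  , (λ (_ , rstep) → let en = fw-enabled (fw-requires-writing σ rstep) in
       en , jointly-enabled σ M t r (λ _ → ⇔-id _) (λ _ → ⇔-id _) en (_ , rstep))
  , (λ d (_ , rstep) → let en = fr-enabled (fr-requires-reading σ rstep) d in
       en , jointly-enabled σ M t r (λ _ → ⇔-id _) (λ _ → ⇔-id _) en (_ , rstep))
  where
    open Model M

    tracking : TrackingPath σ M t (th s t) (rg s)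
    tracking = reachable⇒consistent σ M reachable t

    tracks : Tracks σ t (lastAct σ (proj₁ tracking)) (rg s r)
    tracks = proj₂ tracking r

    fw-enabled : Writing σ (rg s r) t → ThEnabled σ M s t (fw t r)
    fw-enabled wr = sw-last⇒fw-enabled σ (thread t) (proj₁ tracking) (proj₂ (Tracks.writing⇒sw tracks wr))

    fr-enabled : Reading σ (rg s r) t → ∀ d → ThEnabled σ M s t (fr t r d)
    fr-enabled rd = sr-last⇒fr-enabled σ (thread t) (proj₁ tracking) (Tracks.reading⇒sr tracks rd)
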